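{- Let $c$ be a positive integer and let $(L,Q_1,\ldots,Q_n,R)$ be a $(4,c)$-flexipath in a matroid $M$. Then for all $i\in[n]$, $\sqcap(L,Q_i)=\sqcap(R,Q_i)$.
   Context: Let $M$ be a matroid on ground set $E$ with rank function $r$. $\lambda(A)=r(A)+r(E-A)-r(M)$; for disjoint $X,Y$, $\sqcap(X,Y)=r(X)+r(Y)-r(X\cup Y)$; $\kappa(X,Y)=\min\{\lambda(Z):X\subseteq Z\subseteq E-Y\}$. A path of $4$-separations is an ordered partition $(L,P_1,\ldots,P_n,R)$ of $E$ with $\kappa(L,R)=3$ and $\lambda(L\cup P_1\cup\cdots\cup P_i)=3$ for all $i\in\{0,\ldots,n\}$; a $4$-flexipath if this holds for every reordering of $P_1,\ldots,P_n$ (with $L,R$ fixed); a $(4,c)$-flexipath if moreover $\lambda(P_i)=c$ for all $i$ and $\lambda(P_i\cup P_j)>c$ for all distinct $i,j$. -}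

module Defs where

open import Data.Nat using (ℕ; _+_; _∸_; _≤_; _>_)
open import Data.Fin using (Fin)
open import Data.Fin.Subset using (Subset; _∪_; _∩_; ∁; ⊤; _⊆_; ∣_∣; Empty; ⋃)
open import Data.Fin.Permutation using (Permutation′; _⟨$⟩ʳ_)
open import Data.List using (List; map; take; allFin)
open import Data.Product using (Σ; _×_)
open import Relation.Binary.PropositionalEquality using (_≡_; _≢_)

record Matroid (m : ℕ) : Set where
  field
    r          : Subset m → ℕ
    r-bounded  : ∀ X → r X ≤ ∣ X ∣
    r-mono     : ∀ X Y → X ⊆ Y → r X ≤ r Y
    r-submod   : ∀ X Y → r (X ∪ Y) + r (X ∩ Y) ≤ r X + r Y

module _ {m : ℕ} (M : Matroid m) where
  open Matroid M

  rM : ℕ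
  rM = r ⊤

  -- connectivity function λ(A) = r(A) + r(E - A) - r(M)   (always ≥ 0)
  conn : Subset m → ℕ
  conn A = (r A + r (∁ A)) ∸ rM

  -- local connectivity ⊓(X,Y) = r(X) + r(Y) - r(X ∪ Y)   (always ≥ 0)
  sqcap : Subset m → Subset m → ℕ
  sqcap X Y = (r X + r Y) ∸ r (X ∪ Y)

  -- κ(X,Y) = k, unfolding the minimum over Z with X ⊆ Z ⊆ E - Y
  κ≡ : Subset m → Subset m → ℕ → Set
  κ≡ X Y k =
    Σ (Subset m) (λ Z → X ⊆ Z × Z ⊆ ∁ Y × conn Z ≡ k)
    × (∀ Z → X ⊆ Z → Z ⊆ ∁ Y → k ≤ conn Z)

  Disjoint : Subset m → Subset m → Set
  Disjoint A B = Empty (A ∩ B)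

  IsOrderedPartition : (n : ℕ) → Subset m → (Fin n → Subset m) → Subset m → Set
  IsOrderedPartition n L P R =
    Disjoint L R
    × (∀ i → Disjoint L (P i))
    × (∀ i → Disjoint (P i) R)
    × (∀ i j → i ≢ j → Disjoint (P i) (P j))
    × (⊤ ⊆ (L ∪ (R ∪ ⋃ (map P (allFin n)))))

  prefix : (n : ℕ) → Subset m → (Fin n → Subset m) → ℕ → Subset m
  prefix n L P i = L ∪ ⋃ (take i (map P (allFin n)))

  IsPath4 : (n : ℕ) → Subset m → (Fin n → Subset m) → Subset m → Set
  IsPath4 n L P R =
    IsOrderedPartition n L P R
    × κ≡ L R 3
    × (∀ i → i ≤ n → conn (prefix n L P i) ≡ 3)

  IsFlexipath4 : (n : ℕ) → Subset m → (Fin n → Subset m) → Subset m → Set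
  IsFlexipath4 n L P R =
    ∀ (σ : Permutation′ n) → IsPath4 n L (λ i → P (σ ⟨$⟩ʳ i)) R

  IsFlexipath4c : ℕ → (n : ℕ) → Subset m → (Fin n → Subset m) → Subset m → Set
  IsFlexipath4c c n L P R =
    IsFlexipath4 n L P R
    × (∀ i → conn (P i) ≡ c)
    × (∀ i j → i ≢ j → conn (P i ∪ P j) > c)

{-# OPTIONS --safe #-}
module Submission where

-- Move Q i to the front and to the back of the flexipath. Then X = L ∪ Q i and
-- Y = E - (R ∪ Q i) are 4-separations, and so are X ∩ Y = L and X ∪ Y = E - R.
-- Hence λ(X) + λ(Y) = λ(X ∪ Y) + λ(X ∩ Y), which forces equality in the
-- submodular inequality for r on the complements E - X, E - Y. Together with
-- λ(L ∪ Q i) = λ(L) this yields r(L ∪ Q i) + r(R) = r(L) + r(R ∪ Q i),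
-- that is ⊓(L, Q i) = ⊓(R, Q i).

open import Defs
open import Data.Nat using (ℕ; zero; suc; _+_; _∸_; _≤_; _<_; _≥_; z≤n; s≤s; z<s; s<s)
open import Data.Nat.Properties
  using (+-comm; ≤-antisym; ≤-trans; ≤-refl; +-cancelˡ-≤; +-cancelʳ-≡; +-monoˡ-≤;
         m≤m+n; n≤1+n; m∸n+n≡m; <-irrefl; [m+n]∸[m+o]≡n∸o; +-commutativeSemigroup)
open import Algebra.Properties.CommutativeSemigroup +-commutativeSemigroup using (interchange; x∙yz≈y∙xz)
open import Data.Fin using (Fin; zero; suc; toℕ; fromℕ)
open import Data.Fin.Properties using (_≟_; toℕ<n; toℕ-fromℕ; ≤fromℕ; ≤∧≢⇒<)
open import Data.Fin.Subset using (Subset; _∪_; _∩_; ∁; ⊥; _⊆_; _∈_; _∉_; ⋃)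
open import Data.Fin.Subset.Properties
  using (x∈p∪q⁻; x∈p∪q⁺; x∈p∩q⁺; x∈p∩q⁻; x∈∁p⇒x∉p; x∉p⇒x∈∁p; ∉⊥; ∈⊤; _∈?_; ⊆-antisym;
         p∪∁p≡⊤; ∪-identityʳ; ∪-∩-booleanAlgebra)
import Algebra.Lattice.Properties.BooleanAlgebra as BooleanAlgebraProperties
open import Data.Fin.Permutation using (Permutation′; _⟨$⟩ʳ_; transpose)
import Data.Fin.Permutation as Permutation
open import Data.List using (take; tabulate)
open import Data.List.Properties using (map-tabulate)
open import Data.Product using (∃-syntax; _×_; _,_; proj₁; proj₂)
open import Data.Sum using (_⊎_; inj₁; inj₂; [_,_])
open import Data.Empty using (⊥-elim)
open import Function using (id; _∘_)
open import Relation.Nullary using (yes; no)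
open import Relation.Nullary.Decidable using (dec-true)
open import Relation.Binary.PropositionalEquality
  using (_≡_; _≢_; refl; sym; trans; cong; cong₂; subst; module ≡-Reasoning)

open ≡-Reasoning

m≤n⇒o≤p⇒m+o≡n+p⇒o≡p : ∀ {m n o p} → m ≤ n → o ≤ p → m + o ≡ n + p → o ≡ p
m≤n⇒o≤p⇒m+o≡n+p⇒o≡p {m} {n} {o} {p} m≤n o≤p m+o≡n+p = ≤-antisym o≤p p≤o
  where
  p≤o : p ≤ o
  p≤o = +-cancelˡ-≤ n p o (subst (_≤ n + o) m+o≡n+p (+-monoˡ-≤ o m≤n))

m+n≡o+p⇒[o+q]∸m≡[n+q]∸p : ∀ m n o p q → m + n ≡ o + p → (o + q) ∸ m ≡ (n + q) ∸ p
m+n≡o+p⇒[o+q]∸m≡[n+q]∸p m n o p q m+n≡o+p = begin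
  (o + q) ∸ m              ≡⟨ [m+n]∸[m+o]≡n∸o n (o + q) m ⟨
  (n + (o + q)) ∸ (n + m)  ≡⟨ cong₂ _∸_ (x∙yz≈y∙xz n o q) (trans (+-comm n m) m+n≡o+p) ⟩
  (o + (n + q)) ∸ (o + p)  ≡⟨ [m+n]∸[m+o]≡n∸o o (n + q) p ⟩
  (n + q) ∸ p              ∎

x∉p∪q⁺ : ∀ {m} {x : Fin m} {p q : Subset m} → x ∉ p → x ∉ q → x ∉ p ∪ q
x∉p∪q⁺ {p = p} {q} x∉p x∉q = [ x∉p , x∉q ] ∘ x∈p∪q⁻ p q

∈-⋃-tabulate⁻ : ∀ {m n} {x : Fin m} (P : Fin n → Subset m) → x ∈ ⋃ (tabulate P) → ∃[ j ] x ∈ P j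
∈-⋃-tabulate⁻ {n = zero} P x∈ = ⊥-elim (∉⊥ x∈)
∈-⋃-tabulate⁻ {n = suc n} P x∈ with x∈p∪q⁻ (P zero) _ x∈
... | inj₁ x∈P₀ = zero , x∈P₀
... | inj₂ x∈⋃ with ∈-⋃-tabulate⁻ (P ∘ suc) x∈⋃
...   | j , x∈Pj = suc j , x∈Pj

∈-⋃-take-tabulate⁻ : ∀ {m n} {x : Fin m} k (P : Fin n → Subset m) →
                     x ∈ ⋃ (take k (tabulate P)) → ∃[ j ] toℕ j < k × x ∈ P j
∈-⋃-take-tabulate⁻ zero P x∈ = ⊥-elim (∉⊥ x∈)
∈-⋃-take-tabulate⁻ {n = zero} (suc k) P x∈ = ⊥-elim (∉⊥ x∈)
∈-⋃-take-tabulate⁻ {n = suc n} (suc k) P x∈ with x∈p∪q⁻ (P zero) _ x∈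
... | inj₁ x∈P₀ = zero , z<s , x∈P₀
... | inj₂ x∈⋃ with ∈-⋃-take-tabulate⁻ k (P ∘ suc) x∈⋃
...   | j , j<k , x∈Pj = suc j , s<s j<k , x∈Pj

∈-⋃-take-tabulate⁺ : ∀ {m n} {x : Fin m} k (P : Fin n → Subset m) j →
                     toℕ j < k → x ∈ P j → x ∈ ⋃ (take k (tabulate P))
∈-⋃-take-tabulate⁺ (suc k) P zero _ x∈P₀ = x∈p∪q⁺ (inj₁ x∈P₀)
∈-⋃-take-tabulate⁺ (suc k) P (suc j) (s<s j<k) x∈Pj =
  x∈p∪q⁺ (inj₂ (∈-⋃-take-tabulate⁺ k (P ∘ suc) j j<k x∈Pj))

transpose-sends : ∀ {n} (j i : Fin n) → transpose j i ⟨$⟩ʳ j ≡ i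
transpose-sends j i rewrite dec-true (j ≟ j) refl = refl

module _ {m : ℕ} (M : Matroid m) where
  open Matroid M
  open BooleanAlgebraProperties (∪-∩-booleanAlgebra m) using (deMorgan₁; deMorgan₂; ¬-involutive)

  disjoint⇒∉ : ∀ {A B x} → Disjoint M A B → x ∈ A → x ∉ B
  disjoint⇒∉ A#B x∈A x∈B = A#B (_ , x∈p∩q⁺ (x∈A , x∈B))

  rM≤r+r∁ : ∀ A → rM M ≤ r A + r (∁ A)
  rM≤r+r∁ A = subst (_≤ r A + r (∁ A)) (cong r (p∪∁p≡⊤ A))
                    (≤-trans (m≤m+n _ _) (r-submod A (∁ A)))

  r+r∁≡conn+rM : ∀ A → r A + r (∁ A) ≡ conn M A + rM M
  r+r∁≡conn+rM A = sym (m∸n+n≡m (rM≤r+r∁ A))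

  conn-∁ : ∀ A → conn M (∁ A) ≡ conn M A
  conn-∁ A = cong (_∸ rM M) (trans (cong (λ Z → r (∁ A) + r Z) (¬-involutive A)) (+-comm (r (∁ A)) (r A)))

  r∁-submod : ∀ X Y → r (∁ (X ∪ Y)) + r (∁ (X ∩ Y)) ≤ r (∁ X) + r (∁ Y)
  r∁-submod X Y = subst (_≤ r (∁ X) + r (∁ Y)) deMorgan (r-submod (∁ X) (∁ Y))
    where
    deMorgan : r (∁ X ∪ ∁ Y) + r (∁ X ∩ ∁ Y) ≡ r (∁ (X ∪ Y)) + r (∁ (X ∩ Y))
    deMorgan = trans (+-comm (r (∁ X ∪ ∁ Y)) (r (∁ X ∩ ∁ Y))) (sym (cong₂ _+_ (cong r (deMorgan₂ X Y)) (cong r (deMorgan₁ X Y))))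

  conn-modular⇒r∁-modular : ∀ X Y → conn M X + conn M Y ≡ conn M (X ∪ Y) + conn M (X ∩ Y) →
                            r (∁ (X ∪ Y)) + r (∁ (X ∩ Y)) ≡ r (∁ X) + r (∁ Y)
  conn-modular⇒r∁-modular X Y conn-modular =
    m≤n⇒o≤p⇒m+o≡n+p⇒o≡p (r-submod X Y) (r∁-submod X Y) (begin
      (r (X ∪ Y) + r (X ∩ Y)) + (r (∁ (X ∪ Y)) + r (∁ (X ∩ Y)))
        ≡⟨ interchange (r (X ∪ Y)) (r (X ∩ Y)) (r (∁ (X ∪ Y))) (r (∁ (X ∩ Y))) ⟩
      (r (X ∪ Y) + r (∁ (X ∪ Y))) + (r (X ∩ Y) + r (∁ (X ∩ Y)))
        ≡⟨ cong₂ _+_ (r+r∁≡conn+rM (X ∪ Y)) (r+r∁≡conn+rM (X ∩ Y)) ⟩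
      (conn M (X ∪ Y) + rM M) + (conn M (X ∩ Y) + rM M)
        ≡⟨ interchange (conn M (X ∪ Y)) (rM M) (conn M (X ∩ Y)) (rM M) ⟩
      (conn M (X ∪ Y) + conn M (X ∩ Y)) + (rM M + rM M)
        ≡⟨ cong (_+ (rM M + rM M)) conn-modular ⟨
      (conn M X + conn M Y) + (rM M + rM M)
        ≡⟨ interchange (conn M X) (conn M Y) (rM M) (rM M) ⟩
      (conn M X + rM M) + (conn M Y + rM M)
        ≡⟨ cong₂ _+_ (r+r∁≡conn+rM X) (r+r∁≡conn+rM Y) ⟨
      (r X + r (∁ X)) + (r Y + r (∁ Y))
        ≡⟨ interchange (r X) (r (∁ X)) (r Y) (r (∁ Y)) ⟩
      (r X + r Y) + (r (∁ X) + r (∁ Y)) ∎)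

  sqcap-transfer : ∀ {L Q R} → Disjoint M L Q → Disjoint M L R → Disjoint M Q R →
                   conn M (L ∪ Q) ≡ conn M L → conn M (R ∪ Q) ≡ conn M R →
                   sqcap M L Q ≡ sqcap M R Q
  sqcap-transfer {L} {Q} {R} L#Q L#R Q#R conn[L∪Q]≡connL conn[R∪Q]≡connR =
    m+n≡o+p⇒[o+q]∸m≡[n+q]∸p (r X) (r R) (r L) (r (R ∪ Q)) (r Q) exchange
    where
    X Y : Subset m
    X = L ∪ Q
    Y = ∁ (R ∪ Q)

    X∩Y≡L : X ∩ Y ≡ L
    X∩Y≡L = ⊆-antisym X∩Y⊆L L⊆X∩Y
      where
      X∩Y⊆L : X ∩ Y ⊆ L
      X∩Y⊆L x∈X∩Y with x∈p∩q⁻ X Y x∈X∩Y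
      ... | x∈X , x∈Y with x∈p∪q⁻ L Q x∈X
      ...   | inj₁ x∈L = x∈L
      ...   | inj₂ x∈Q = ⊥-elim (x∈∁p⇒x∉p x∈Y (x∈p∪q⁺ (inj₂ x∈Q)))
      L⊆X∩Y : L ⊆ X ∩ Y
      L⊆X∩Y x∈L = x∈p∩q⁺ (x∈p∪q⁺ (inj₁ x∈L) ,
                           x∉p⇒x∈∁p (x∉p∪q⁺ (disjoint⇒∉ L#R x∈L) (disjoint⇒∉ L#Q x∈L)))

    X∪Y≡∁R : X ∪ Y ≡ ∁ R
    X∪Y≡∁R = ⊆-antisym X∪Y⊆∁R ∁R⊆X∪Y
      where
      X∪Y⊆∁R : X ∪ Y ⊆ ∁ R
      X∪Y⊆∁R {x} x∈X∪Y = x∉p⇒x∈∁p x∉R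
        where
        x∉R : x ∉ R
        x∉R x∈R with x∈p∪q⁻ X Y x∈X∪Y
        ... | inj₂ x∈Y = x∈∁p⇒x∉p x∈Y (x∈p∪q⁺ (inj₁ x∈R))
        ... | inj₁ x∈X with x∈p∪q⁻ L Q x∈X
        ...   | inj₁ x∈L = disjoint⇒∉ L#R x∈L x∈R
        ...   | inj₂ x∈Q = disjoint⇒∉ Q#R x∈Q x∈R
      ∁R⊆X∪Y : ∁ R ⊆ X ∪ Y
      ∁R⊆X∪Y {x} x∈∁R with x ∈? Q
      ... | yes x∈Q = x∈p∪q⁺ (inj₁ (x∈p∪q⁺ (inj₂ x∈Q)))
      ... | no x∉Q = x∈p∪q⁺ (inj₂ (x∉p⇒x∈∁p (x∉p∪q⁺ (x∈∁p⇒x∉p x∈∁R) x∉Q)))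

    conn-modular : conn M X + conn M Y ≡ conn M (X ∪ Y) + conn M (X ∩ Y)
    conn-modular = begin
      conn M X + conn M Y
        ≡⟨ cong₂ _+_ conn[L∪Q]≡connL (trans (conn-∁ (R ∪ Q)) conn[R∪Q]≡connR) ⟩
      conn M L + conn M R
        ≡⟨ +-comm (conn M L) (conn M R) ⟩
      conn M R + conn M L
        ≡⟨ cong₂ _+_ (trans (sym (conn-∁ R)) (cong (conn M) (sym X∪Y≡∁R))) (cong (conn M) (sym X∩Y≡L)) ⟩
      conn M (X ∪ Y) + conn M (X ∩ Y) ∎

    r∁-tight : r R + r (∁ L) ≡ r (∁ X) + r (R ∪ Q)
    r∁-tight = begin
      r R + r (∁ L)
        ≡⟨ cong₂ (λ A B → r A + r (∁ B)) (trans (sym (¬-involutive R)) (cong ∁ (sym X∪Y≡∁R))) (sym X∩Y≡L) ⟩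
      r (∁ (X ∪ Y)) + r (∁ (X ∩ Y))
        ≡⟨ conn-modular⇒r∁-modular X Y conn-modular ⟩
      r (∁ X) + r (∁ Y)
        ≡⟨ cong (λ A → r (∁ X) + r A) (¬-involutive (R ∪ Q)) ⟩
      r (∁ X) + r (R ∪ Q) ∎

    conn-balance : r X + r (∁ X) ≡ r L + r (∁ L)
    conn-balance = trans (r+r∁≡conn+rM X) (trans (cong (_+ rM M) conn[L∪Q]≡connL) (sym (r+r∁≡conn+rM L)))

    exchange : r X + r R ≡ r L + r (R ∪ Q)
    exchange = +-cancelʳ-≡ (r (∁ X) + r (∁ L)) (r X + r R) (r L + r (R ∪ Q)) (begin
      (r X + r R) + (r (∁ X) + r (∁ L))
        ≡⟨ interchange (r X) (r R) (r (∁ X)) (r (∁ L)) ⟩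
      (r X + r (∁ X)) + (r R + r (∁ L))
        ≡⟨ cong₂ _+_ conn-balance r∁-tight ⟩
      (r L + r (∁ L)) + (r (∁ X) + r (R ∪ Q))
        ≡⟨ cong (r L + r (∁ L) +_) (+-comm (r (∁ X)) (r (R ∪ Q))) ⟩
      (r L + r (∁ L)) + (r (R ∪ Q) + r (∁ X))
        ≡⟨ interchange (r L) (r (∁ L)) (r (R ∪ Q)) (r (∁ X)) ⟩
      (r L + r (R ∪ Q)) + (r (∁ L) + r (∁ X))
        ≡⟨ cong (r L + r (R ∪ Q) +_) (+-comm (r (∁ L)) (r (∁ X))) ⟩
      (r L + r (R ∪ Q)) + (r (∁ X) + r (∁ L)) ∎)

  prefix≡L∪⋃take : ∀ n L (P : Fin n → Subset m) k → prefix M n L P k ≡ L ∪ ⋃ (take k (tabulate P))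
  prefix≡L∪⋃take n L P k = cong (λ Ps → L ∪ ⋃ (take k Ps)) (map-tabulate id P)

  ∈-prefix⁻ : ∀ {x} n L (P : Fin n → Subset m) k →
              x ∈ prefix M n L P k → x ∈ L ⊎ ∃[ j ] toℕ j < k × x ∈ P j
  ∈-prefix⁻ {x} n L P k x∈ with x∈p∪q⁻ L _ (subst (x ∈_) (prefix≡L∪⋃take n L P k) x∈)
  ... | inj₁ x∈L = inj₁ x∈L
  ... | inj₂ x∈⋃ = inj₂ (∈-⋃-take-tabulate⁻ k P x∈⋃)

  ∈-prefix⁺ : ∀ {x} n L (P : Fin n → Subset m) k →
              x ∈ L ⊎ ∃[ j ] toℕ j < k × x ∈ P j → x ∈ prefix M n L P k
  ∈-prefix⁺ {x} n L P k x∈ = subst (x ∈_) (sym (prefix≡L∪⋃take n L P k)) (x∈p∪q⁺ (lift x∈))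
    where
    lift : x ∈ L ⊎ ∃[ j ] toℕ j < k × x ∈ P j → x ∈ L ⊎ x ∈ ⋃ (take k (tabulate P))
    lift (inj₁ x∈L) = inj₁ x∈L
    lift (inj₂ (j , j<k , x∈Pj)) = inj₂ (∈-⋃-take-tabulate⁺ k P j j<k x∈Pj)

  ∈-partition : ∀ {n L P R} → IsOrderedPartition M n L P R →
                ∀ x → x ∈ L ⊎ x ∈ R ⊎ ∃[ j ] x ∈ P j
  ∈-partition {n} {L} {P} {R} (_ , _ , _ , _ , cover) x with x∈p∪q⁻ L _ (cover (∈⊤ {x = x}))
  ... | inj₁ x∈L = inj₁ x∈L
  ... | inj₂ x∈R∪⋃ with x∈p∪q⁻ R _ x∈R∪⋃
  ...   | inj₁ x∈R = inj₂ (inj₁ x∈R)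
  ...   | inj₂ x∈⋃ = inj₂ (inj₂ (∈-⋃-tabulate⁻ P (subst (λ Ps → x ∈ ⋃ Ps) (map-tabulate id P) x∈⋃)))

  prefix-all : ∀ {n L P R} → IsOrderedPartition M n L P R → prefix M n L P n ≡ ∁ R
  prefix-all {n} {L} {P} {R} partition@(L#R , _ , P#R , _ , _) = ⊆-antisym prefix⊆∁R ∁R⊆prefix
    where
    prefix⊆∁R : prefix M n L P n ⊆ ∁ R
    prefix⊆∁R x∈ with ∈-prefix⁻ n L P n x∈
    ... | inj₁ x∈L = x∉p⇒x∈∁p (disjoint⇒∉ L#R x∈L)
    ... | inj₂ (j , _ , x∈Pj) = x∉p⇒x∈∁p (disjoint⇒∉ (P#R j) x∈Pj)
    ∁R⊆prefix : ∁ R ⊆ prefix M n L P n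
    ∁R⊆prefix {x} x∈∁R with ∈-partition partition x
    ... | inj₁ x∈L = ∈-prefix⁺ n L P n (inj₁ x∈L)
    ... | inj₂ (inj₁ x∈R) = ⊥-elim (x∈∁p⇒x∉p x∈∁R x∈R)
    ... | inj₂ (inj₂ (j , x∈Pj)) = ∈-prefix⁺ n L P n (inj₂ (j , toℕ<n j , x∈Pj))

  prefix-all-but-last : ∀ {n L P R} → IsOrderedPartition M (suc n) L P R →
                        prefix M (suc n) L P n ≡ ∁ (R ∪ P (fromℕ n))
  prefix-all-but-last {n} {L} {P} {R} partition@(L#R , L#P , P#R , P#P , _) =
    ⊆-antisym prefix⊆∁ ∁⊆prefix
    where
    last : Fin (suc n)
    last = fromℕ n
    prefix⊆∁ : prefix M (suc n) L P n ⊆ ∁ (R ∪ P last)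
    prefix⊆∁ x∈ with ∈-prefix⁻ (suc n) L P n x∈
    ... | inj₁ x∈L = x∉p⇒x∈∁p (x∉p∪q⁺ (disjoint⇒∉ L#R x∈L) (disjoint⇒∉ (L#P last) x∈L))
    ... | inj₂ (j , j<n , x∈Pj) =
      x∉p⇒x∈∁p (x∉p∪q⁺ (disjoint⇒∉ (P#R j) x∈Pj) (disjoint⇒∉ (P#P j last j≢last) x∈Pj))
      where
      j≢last : j ≢ last
      j≢last j≡last = <-irrefl (trans (cong toℕ j≡last) (toℕ-fromℕ n)) j<n
    ∁⊆prefix : ∁ (R ∪ P last) ⊆ prefix M (suc n) L P n
    ∁⊆prefix {x} x∈∁ with ∈-partition partition x
    ... | inj₁ x∈L = ∈-prefix⁺ (suc n) L P n (inj₁ x∈L)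
    ... | inj₂ (inj₁ x∈R) = ⊥-elim (x∈∁p⇒x∉p x∈∁ (x∈p∪q⁺ (inj₁ x∈R)))
    ... | inj₂ (inj₂ (j , x∈Pj)) with j ≟ last
    ...   | yes refl = ⊥-elim (x∈∁p⇒x∉p x∈∁ (x∈p∪q⁺ (inj₂ x∈Pj)))
    ...   | no j≢last = ∈-prefix⁺ (suc n) L P n (inj₂ (j , j<n , x∈Pj))
      where
      j<n : toℕ j < n
      j<n = subst (toℕ j <_) (toℕ-fromℕ n) (≤∧≢⇒< (≤fromℕ j) j≢last)

  flexipath-conn[L∪Q]≡connL : ∀ {n L Q R} → IsFlexipath4 M (suc n) L Q R →
                              ∀ i → conn M (L ∪ Q i) ≡ conn M L
  flexipath-conn[L∪Q]≡connL {n} {L} {Q} {R} flexipath i = begin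
    conn M (L ∪ Q i)                 ≡⟨ cong (λ A → conn M (L ∪ A)) Qi≡P₀∪⊥ ⟩
    conn M (prefix M (suc n) L P 1)  ≡⟨ conn-prefix 1 (s≤s z≤n) ⟩
    3                                ≡⟨ conn-prefix 0 z≤n ⟨
    conn M (prefix M (suc n) L P 0)  ≡⟨ cong (conn M) (∪-identityʳ L) ⟩
    conn M L                         ∎
    where
    σ : Permutation′ (suc n)
    σ = transpose zero i
    P : Fin (suc n) → Subset m
    P j = Q (σ ⟨$⟩ʳ j)
    conn-prefix : ∀ k → k ≤ suc n → conn M (prefix M (suc n) L P k) ≡ 3
    conn-prefix = proj₂ (proj₂ (flexipath σ))
    Qi≡P₀∪⊥ : Q i ≡ P zero ∪ ⊥
    Qi≡P₀∪⊥ = trans (cong Q (sym (transpose-sends zero i))) (sym (∪-identityʳ (P zero)))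

  flexipath-conn[R∪Q]≡connR : ∀ {n L Q R} → IsFlexipath4 M (suc n) L Q R →
                              ∀ i → conn M (R ∪ Q i) ≡ conn M R
  flexipath-conn[R∪Q]≡connR {n} {L} {Q} {R} flexipath i = begin
    conn M (R ∪ Q i)                       ≡⟨ conn-∁ (R ∪ Q i) ⟨
    conn M (∁ (R ∪ Q i))                   ≡⟨ cong (λ j → conn M (∁ (R ∪ Q j))) (transpose-sends last i) ⟨
    conn M (∁ (R ∪ P last))                ≡⟨ cong (conn M) (prefix-all-but-last partition) ⟨
    conn M (prefix M (suc n) L P n)        ≡⟨ conn-prefix n (n≤1+n n) ⟩
    3                                      ≡⟨ conn-prefix (suc n) ≤-refl ⟨
    conn M (prefix M (suc n) L P (suc n))  ≡⟨ cong (conn M) (prefix-all partition) ⟩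
    conn M (∁ R)                           ≡⟨ conn-∁ R ⟩
    conn M R                               ∎
    where
    last : Fin (suc n)
    last = fromℕ n
    σ : Permutation′ (suc n)
    σ = transpose last i
    P : Fin (suc n) → Subset m
    P j = Q (σ ⟨$⟩ʳ j)
    partition : IsOrderedPartition M (suc n) L P R
    partition = proj₁ (flexipath σ)
    conn-prefix : ∀ k → k ≤ suc n → conn M (prefix M (suc n) L P k) ≡ 3
    conn-prefix = proj₂ (proj₂ (flexipath σ))

lemma4p3 : {m : ℕ} (M : Matroid m) (c : ℕ) → c ≥ 1 →
    (n : ℕ) (L : Subset m) (Q : Fin n → Subset m) (R : Subset m) →
    IsFlexipath4c M c n L Q R →
    ∀ (i : Fin n) → sqcap M L (Q i) ≡ sqcap M R (Q i)
lemma4p3 M c _ (suc n) L Q R (flexipath , _) i with proj₁ (flexipath Permutation.id)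
... | L#R , L#Q , Q#R , _ =
  sqcap-transfer M (L#Q i) L#R (Q#R i)
    (flexipath-conn[L∪Q]≡connL M flexipath i) (flexipath-conn[R∪Q]≡connR M flexipath i)
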